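{- Let $S$ and $T$ be two superperfect subtrees of $(\omega)^{<\omega}$ and let $s$ and $t$ be $\infty$-splitting nodes of $S$ and $T$ respectively. Then for every $n<\omega$ there are $\infty$-splitting nodes $s'$ of $S$ and $t'$ of $T$ such that $s\sqsubseteq s'$, $t\sqsubseteq t'$ and $\operatorname{osc}(s',t')=\operatorname{osc}(s,t)+n$.
   Context: $(\omega)^{<\omega}$ is the set of strictly increasing functions from some $n<\omega$ to $\omega$, a tree under the initial-segment relation $\sqsubseteq$; a subtree is a subset closed under initial segments. A node $t$ of a subtree $T$ is $\infty$-splitting if for every $k$ there is $u\in T$ with $t\sqsubseteq u$ and $u(|t|)>k$; $T$ is superperfect if every node of $T$ has an $\infty$-splitting extension in $T$. For $s,t\in(\omega)^{\le\omega}$, $\operatorname{osc}(s,t)=|\{n<\omega: s(n)\le t(n)\text{ and }s(n+1)>t(n+1)\}|$, where only $n$ with $n+1$ in the domain of both $s$ and $t$ are counted. -}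

module Defs where

open import Data.Nat using (ℕ; zero; suc; _+_; _≤_; _<_; _≤?_; _<?_)
open import Data.List using (List; []; _∷_; _++_; length)
open import Data.List.Relation.Unary.Linked using (Linked)
open import Data.Maybe using (Maybe; just; nothing)
open import Data.Product using (Σ; ∃; _×_; _,_)
open import Data.Bool using (_∧_)
open import Relation.Nullary.Decidable using (⌊_⌋)
open import Relation.Binary.PropositionalEquality using (_≡_)

-- Nodes of (ω)^{<ω}: finite lists of naturals that are strictly increasing.
StrictlyIncreasing : List ℕ → Set
StrictlyIncreasing = Linked _<_

_⊑_ : List ℕ → List ℕ → Set
s ⊑ u = ∃ λ w → s ++ w ≡ u

_at_ : List ℕ → ℕ → Maybe ℕ
[] at i = nothing
(x ∷ u) at zero = just x
(x ∷ u) at suc i = u at i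

record IsSubtree (T : List ℕ → Set) : Set where
  field
    increasing : ∀ u → T u → StrictlyIncreasing u
    closed     : ∀ s u → s ⊑ u → T u → T s

InfSplitting : (List ℕ → Set) → List ℕ → Set
InfSplitting T t =
  T t × (∀ k → ∃ λ u → T u × t ⊑ u × ∃ λ x → (u at length t ≡ just x) × k < x)

record Superperfect (T : List ℕ → Set) : Set where
  field
    subtree  : IsSubtree T
    splitExt : ∀ t → T t → ∃ λ u → t ⊑ u × InfSplitting T u

-- osc(s,t) = |{n : s(n) ≤ t(n) and s(n+1) > t(n+1)}|, counting only n
-- with n+1 in the domain of both.
osc : List ℕ → List ℕ → ℕ
osc (a ∷ a' ∷ s) (b ∷ b' ∷ t) =
  (if' (⌊ a ≤? b ⌋ ∧ ⌊ b' <? a' ⌋)) + osc (a' ∷ s) (b' ∷ t)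
  where
  open import Data.Bool using (Bool; true; false)
  if' : Bool → ℕ
  if' true = 1
  if' false = 0
osc _ _ = 0

module Submission where

-- Write s ≪ v when every entry of s is smaller than every
-- entry of v.  Appending a block of entries that dominate the other
-- sequence changes osc in a completely controlled way:
--   * appending v ≫ s to t does not change osc s t          (osc-++-largeʳ);
--   * appending w ≫ t to s adds the "pending crossing" of s over t, i.e.
--     1 if t reaches past s and the last entry of s is ≤ the aligned
--     entry of t, and 0 otherwise                             (osc-++-largeˡ);
--   * if t ≪ v and |t| < |s| < |t| + |v|, then s has a pending crossing
--     over t ++ v                                              (pending-large).
-- In a superperfect tree every ∞-splitting node has ∞-splitting extensions
-- by arbitrarily long blocks of arbitrarily large entries
-- (longLargeExtension).  Combining these, any pair of ∞-splitting nodes can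
-- be extended to ∞-splitting nodes with exactly one more oscillation
-- (oscillateOnce), and lemma5 follows by induction on n.

open import Defs
open import Data.Nat using (ℕ; _+_)
open import Data.List using (List)
open import Data.Product using (∃₂; _×_)
open import Relation.Binary.PropositionalEquality using (_≡_)

open import Data.Nat using (zero; suc; _≤_; _<_; _≤?_; _<?_; z≤n; s≤s)
open import Data.Nat.Properties
  using ( ≤-trans; ≤-reflexive; <-trans; <⇒≤; <-asym; <⇒≱; ≤-<-trans; m≤n+m
        ; +-mono-≤; +-identityʳ; +-suc; +-commutativeSemigroup)
open import Algebra.Properties.CommutativeSemigroup +-commutativeSemigroup
  using (x∙yz≈y∙xz)
open import Data.List using ([]; _∷_; _++_; length)
open import Data.List.Properties using (++-assoc; ++-identityʳ; length-++)
open import Data.List.Extrema.Nat using (max; xs≤max)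
open import Data.List.Relation.Unary.All using (All; []; _∷_)
import Data.List.Relation.Unary.All.Properties as All
open import Data.List.Relation.Unary.Linked using (Linked; tail)
open import Data.List.Relation.Unary.Linked.Properties using (Linked⇒All)
open import Data.Product using (∃; _,_; proj₁)
open import Data.Sum using (_⊎_; inj₁; inj₂)
open import Data.Maybe using (just)
open import Relation.Nullary using (yes; no; ¬_; contradiction)
open import Relation.Binary.PropositionalEquality
  using (refl; sym; trans; cong; cong₂; subst; module ≡-Reasoning)

⊑-refl : ∀ s → s ⊑ s
⊑-refl s = [] , ++-identityʳ s

⊑-trans : ∀ {s t u} → s ⊑ t → t ⊑ u → s ⊑ u
⊑-trans {s} (w₁ , refl) (w₂ , refl) = w₁ ++ w₂ , sym (++-assoc s w₁ w₂)

entry-after-prefix : ∀ s w {x} → (s ++ w) at length s ≡ just x →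
                     ∃ λ w' → w ≡ x ∷ w'
entry-after-prefix [] (x ∷ w) refl = w , refl
entry-after-prefix (_ ∷ s) w eq = entry-after-prefix s w eq

≤-length-suffix : ∀ {m} (s w : List ℕ) → m ≤ length w → m ≤ length (s ++ w)
≤-length-suffix s w m≤w =
  ≤-trans m≤w (≤-trans (m≤n+m (length w) (length s)) (≤-reflexive (sym (length-++ s))))

linked-suffix : ∀ {A : Set} {R : A → A → Set} (s : List A) {w} →
                Linked R (s ++ w) → Linked R w
linked-suffix []      l = l
linked-suffix (_ ∷ s) l = linked-suffix s (tail l)

module _ (S : List ℕ → Set) (superperfect : Superperfect S) where
  open Superperfect superperfect
  open IsSubtree subtree

  -- An ∞-splitting node has an ∞-splitting proper extension all of whose
  -- new entries exceed K: split above K, then pass to an ∞-splitting node.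
  largeExtension : ∀ s → InfSplitting S s → ∀ K →
                   ∃ λ w → InfSplitting S (s ++ w) × All (K <_) w × 1 ≤ length w
  largeExtension s (_ , splits) K with splits K
  ... | _ , Su , (w₀ , refl) , x , entry≡x , K<x
    with entry-after-prefix s w₀ entry≡x | splitExt (s ++ w₀) Su
  ... | w₀' , refl | _ , (w₁ , refl) , split =
    x ∷ w₀' ++ w₁ , split' , Linked⇒All <-trans K<x increasingTail , s≤s z≤n
    where
    split' : InfSplitting S (s ++ x ∷ w₀' ++ w₁)
    split' = subst (InfSplitting S) (++-assoc s (x ∷ w₀') w₁) split
    increasingTail : Linked _<_ (x ∷ w₀' ++ w₁)
    increasingTail = linked-suffix s (increasing _ (proj₁ split'))

  longLargeExtension : ∀ s → InfSplitting S s → ∀ K L →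
                       ∃ λ w → InfSplitting S (s ++ w) × All (K <_) w × L ≤ length w
  longLargeExtension s split K zero =
    [] , subst (InfSplitting S) (sym (++-identityʳ s)) split , [] , z≤n
  longLargeExtension s split K (suc L) with largeExtension s split K
  ... | w , split₁ , large₁ , long₁ with longLargeExtension (s ++ w) split₁ K L
  ... | w' , split₂ , large₂ , long₂ =
    w ++ w' , subst (InfSplitting S) (++-assoc s w w') split₂ ,
    All.++⁺ large₁ large₂ ,
    ≤-trans (+-mono-≤ long₁ long₂) (≤-reflexive (sym (length-++ w)))

χ≤ : ℕ → ℕ → ℕ
χ≤ a b with a ≤? b
... | yes _ = 1
... | no  _ = 0

χ≤-≤ : ∀ {a b} → a ≤ b → χ≤ a b ≡ 1
χ≤-≤ {a} {b} a≤b with a ≤? b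
... | yes _  = refl
... | no a≰b = contradiction a≤b a≰b

χ≤-≰ : ∀ {a b} → ¬ a ≤ b → χ≤ a b ≡ 0
χ≤-≰ {a} {b} a≰b with a ≤? b
... | yes a≤b = contradiction a≤b a≰b
... | no  _   = refl

crossing : ℕ → ℕ → ℕ → ℕ → ℕ
crossing a b a' b' with b' <? a'
... | yes _ = χ≤ a b
... | no  _ = 0

osc-∷∷ : ∀ a a' s b b' t →
         osc (a ∷ a' ∷ s) (b ∷ b' ∷ t) ≡ crossing a b a' b' + osc (a' ∷ s) (b' ∷ t)
osc-∷∷ a a' s b b' t with b' <? a'
... | no  _ with a ≤? b
...   | yes _ = refl
...   | no  _ = refl
osc-∷∷ a a' s b b' t | yes _ with a ≤? b
...   | yes _ = refl
...   | no  _ = refl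

crossing-< : ∀ {a b a' b'} → b' < a' → crossing a b a' b' ≡ χ≤ a b
crossing-< {a' = a'} {b'} b'<a' with b' <? a'
... | yes _    = refl
... | no b'≮a' = contradiction b'<a' b'≮a'

crossing-≮ : ∀ {a b a' b'} → ¬ b' < a' → crossing a b a' b' ≡ 0
crossing-≮ {a' = a'} {b'} b'≮a' with b' <? a'
... | yes b'<a' = contradiction b'<a' b'≮a'
... | no  _     = refl

crossing-≰ : ∀ {a b a' b'} → ¬ a ≤ b → crossing a b a' b' ≡ 0
crossing-≰ {a' = a'} {b'} a≰b with b' <? a'
... | yes _ = χ≤-≰ a≰b
... | no  _ = refl

-- The crossing that s would complete if it were extended by entries above
-- everything in t: 1 iff t extends past s and last(s) ≤ t(|s| - 1).
pending : List ℕ → List ℕ → ℕ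
pending (a ∷ [])     (b ∷ _ ∷ _)  = χ≤ a b
pending (_ ∷ a' ∷ s) (_ ∷ b' ∷ t) = pending (a' ∷ s) (b' ∷ t)
pending _            _            = 0

pending-binary : ∀ s t → pending s t ≡ 0 ⊎ pending s t ≡ 1
pending-binary (a ∷ []) (b ∷ _ ∷ _) with a ≤? b
... | yes _ = inj₂ refl
... | no  _ = inj₁ refl
pending-binary (_ ∷ a' ∷ s) (_ ∷ b' ∷ t) = pending-binary (a' ∷ s) (b' ∷ t)
pending-binary []           _            = inj₁ refl
pending-binary (_ ∷ [])     []           = inj₁ refl
pending-binary (_ ∷ [])     (_ ∷ [])     = inj₁ refl
pending-binary (_ ∷ _ ∷ _)  []           = inj₁ refl
pending-binary (_ ∷ _ ∷ _)  (_ ∷ [])     = inj₁ refl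

osc-[]ʳ : ∀ s → osc s [] ≡ 0
osc-[]ʳ []          = refl
osc-[]ʳ (_ ∷ [])    = refl
osc-[]ʳ (_ ∷ _ ∷ _) = refl

osc-++-largeʳ : ∀ {K} s t v → All (_≤ K) s → All (K <_) v → osc s (t ++ v) ≡ osc s t
osc-++-largeʳ [] _ _ _ _ = refl
osc-++-largeʳ (_ ∷ []) _ _ _ _ = refl
osc-++-largeʳ (_ ∷ _ ∷ _) [] [] _ _ = refl
osc-++-largeʳ (_ ∷ _ ∷ _) [] (_ ∷ []) _ _ = refl
osc-++-largeʳ (a ∷ a' ∷ s) [] (b ∷ b' ∷ v) (_ ∷ a'≤K ∷ s≤K) (_ ∷ K<b' ∷ K<v) =
  trans (osc-∷∷ a a' s b b' v)
    (cong₂ _+_ (crossing-≮ (<-asym (≤-<-trans a'≤K K<b')))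
               (trans (osc-++-largeʳ (a' ∷ s) [] (b' ∷ v) (a'≤K ∷ s≤K) (K<b' ∷ K<v))
                      (osc-[]ʳ (a' ∷ s))))
osc-++-largeʳ (_ ∷ _ ∷ _) (_ ∷ []) [] _ _ = refl
osc-++-largeʳ (a ∷ a' ∷ s) (b ∷ []) (y ∷ v) (_ ∷ a'≤K ∷ s≤K) (K<y ∷ K<v) =
  trans (osc-∷∷ a a' s b y v)
    (cong₂ _+_ (crossing-≮ (<-asym (≤-<-trans a'≤K K<y)))
               (trans (osc-++-largeʳ (a' ∷ s) [] (y ∷ v) (a'≤K ∷ s≤K) (K<y ∷ K<v))
                      (osc-[]ʳ (a' ∷ s))))
osc-++-largeʳ (a ∷ a' ∷ s) (b ∷ b' ∷ t) v (_ ∷ s≤K) v-large =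
  trans (osc-∷∷ a a' s b b' (t ++ v))
    (trans (cong (crossing a b a' b' +_) (osc-++-largeʳ (a' ∷ s) (b' ∷ t) v s≤K v-large))
           (sym (osc-∷∷ a a' s b b' t)))

osc-++-largeˡ : ∀ {K} s t x w → All (_≤ K) t → All (K <_) (x ∷ w) →
                osc (s ++ x ∷ w) t ≡ pending s t + osc s t
osc-++-largeˡ [] [] x w _ _ = osc-[]ʳ (x ∷ w)
osc-++-largeˡ [] (_ ∷ _) _ [] _ _ = refl
osc-++-largeˡ [] (_ ∷ []) _ (_ ∷ _) _ _ = refl
osc-++-largeˡ [] (b ∷ b' ∷ t) x (y ∷ w) (b≤K ∷ t≤K) (K<x ∷ w-large) =
  trans (osc-∷∷ x y w b b' t)
    (cong₂ _+_ (crossing-≰ {a' = y} {b'} (<⇒≱ (≤-<-trans b≤K K<x)))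
               (osc-++-largeˡ [] (b' ∷ t) y w t≤K w-large))
osc-++-largeˡ (_ ∷ []) [] _ _ _ _ = refl
osc-++-largeˡ (_ ∷ []) (_ ∷ []) _ _ _ _ = refl
osc-++-largeˡ (a ∷ []) (b ∷ b' ∷ t) x w (_ ∷ t≤K@(b'≤K ∷ _)) w-large@(K<x ∷ _) =
  trans (osc-∷∷ a x w b b' t)
    (cong₂ _+_ (crossing-< {a} {b} (≤-<-trans b'≤K K<x))
               (osc-++-largeˡ [] (b' ∷ t) x w t≤K w-large))
osc-++-largeˡ (_ ∷ _ ∷ _) [] _ _ _ _ = refl
osc-++-largeˡ (_ ∷ _ ∷ _) (_ ∷ []) _ _ _ _ = refl
osc-++-largeˡ (a ∷ a' ∷ s) (b ∷ b' ∷ t) x w (_ ∷ t≤K) w-large = begin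
  osc (a ∷ a' ∷ s ++ x ∷ w) (b ∷ b' ∷ t)
    ≡⟨ osc-∷∷ a a' (s ++ x ∷ w) b b' t ⟩
  crossing a b a' b' + osc (a' ∷ s ++ x ∷ w) (b' ∷ t)
    ≡⟨ cong (crossing a b a' b' +_) (osc-++-largeˡ (a' ∷ s) (b' ∷ t) x w t≤K w-large) ⟩
  crossing a b a' b' + (pending (a' ∷ s) (b' ∷ t) + osc (a' ∷ s) (b' ∷ t))
    ≡⟨ x∙yz≈y∙xz (crossing a b a' b') (pending (a' ∷ s) (b' ∷ t)) (osc (a' ∷ s) (b' ∷ t)) ⟩
  pending (a' ∷ s) (b' ∷ t) + (crossing a b a' b' + osc (a' ∷ s) (b' ∷ t))
    ≡⟨ cong (pending (a' ∷ s) (b' ∷ t) +_) (sym (osc-∷∷ a a' s b b' t)) ⟩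
  pending (a' ∷ s) (b' ∷ t) + osc (a ∷ a' ∷ s) (b ∷ b' ∷ t)
    ∎
  where open ≡-Reasoning

-- If t is followed by a block v above everything in s, and s ends strictly
-- inside that block, then the last entry of s lies below the aligned entry.
pending-large : ∀ {K} s t v → All (_≤ K) s → All (K <_) v →
                length t < length s → length s < length t + length v →
                pending s (t ++ v) ≡ 1
pending-large (a ∷ []) [] (b ∷ _ ∷ _) (a≤K ∷ _) (K<b ∷ _) _ _ =
  χ≤-≤ (<⇒≤ (≤-<-trans a≤K K<b))
pending-large (_ ∷ a' ∷ s) [] (_ ∷ b' ∷ v) (_ ∷ s≤K) (_ ∷ v-large) _ (s≤s long) =
  pending-large (a' ∷ s) [] (b' ∷ v) s≤K v-large (s≤s z≤n) long
pending-large (_ ∷ a' ∷ s) (_ ∷ []) (y ∷ v) (_ ∷ s≤K) v-large _ (s≤s long) =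
  pending-large (a' ∷ s) [] (y ∷ v) s≤K v-large (s≤s z≤n) long
pending-large (_ ∷ a' ∷ s) (_ ∷ b' ∷ t) v (_ ∷ s≤K) v-large (s≤s short) (s≤s long) =
  pending-large (a' ∷ s) (b' ∷ t) v s≤K v-large short long
pending-large (_ ∷ []) [] (_ ∷ []) _ _ _ (s≤s ())
pending-large (_ ∷ _ ∷ _) [] (_ ∷ []) _ _ _ (s≤s ())
pending-large (_ ∷ _ ∷ _) (_ ∷ []) [] _ _ _ (s≤s ())
pending-large (_ ∷ []) (_ ∷ _) _ _ _ (s≤s ()) _
pending-large [] _ _ _ _ () _

module _ (S T : List ℕ → Set) (S-sp : Superperfect S) (T-sp : Superperfect T) where

  Reachable : List ℕ → List ℕ → ℕ → Set
  Reachable s t m = ∃₂ λ s' t' → InfSplitting S s' × InfSplitting T t' ×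
                      s ⊑ s' × t ⊑ t' × osc s' t' ≡ m

  Reachable-⊑ : ∀ {s t s₁ t₁ m} → s ⊑ s₁ → t ⊑ t₁ → Reachable s₁ t₁ m → Reachable s t m
  Reachable-⊑ s⊑s₁ t⊑t₁ (s' , t' , s'-split , t'-split , s₁⊑s' , t₁⊑t' , osc≡) =
    s' , t' , s'-split , t'-split , ⊑-trans s⊑s₁ s₁⊑s' , ⊑-trans t⊑t₁ t₁⊑t' , osc≡

  -- When t is shorter than s: extend t past the end of s by entries above
  -- s, then s by entries above the result; the last entry of s is then
  -- below the aligned entry of t and the new entries of s are above it.
  oscillateOnce-shorter : ∀ s t → InfSplitting S s → InfSplitting T t →
                          length t < length s → Reachable s t (suc (osc s t))
  oscillateOnce-shorter s t s-split t-split shorter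
    with longLargeExtension T T-sp t t-split (max 0 s) (suc (length s))
  ... | v , tv-split , v-large , v-long
    with largeExtension S S-sp s s-split (max 0 (t ++ v))
  ... | [] , _ , _ , ()
  ... | x ∷ w , sw-split , w-large , _ =
    s ++ x ∷ w , t ++ v , sw-split , tv-split , (x ∷ w , refl) , (v , refl) , (begin
      osc (s ++ x ∷ w) (t ++ v)
        ≡⟨ osc-++-largeˡ s (t ++ v) x w (xs≤max 0 (t ++ v)) w-large ⟩
      pending s (t ++ v) + osc s (t ++ v)
        ≡⟨ cong₂ _+_ (pending-large s t v (xs≤max 0 s) v-large shorter s<t+v)
                     (osc-++-largeʳ s t v (xs≤max 0 s) v-large) ⟩
      suc (osc s t)
        ∎)
    where
    open ≡-Reasoning
    s<t+v : length s < length t + length v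
    s<t+v = ≤-trans v-long (m≤n+m (length v) (length t))

  -- In general, first extend s beyond t by entries above t.  This either
  -- already completes a pending crossing, or leaves osc unchanged and puts
  -- us in the situation of oscillateOnce-shorter.
  oscillateOnce : ∀ s t → InfSplitting S s → InfSplitting T t →
                  Reachable s t (suc (osc s t))
  oscillateOnce s t s-split t-split
    with longLargeExtension S S-sp s s-split (max 0 t) (suc (length t))
  ... | [] , _ , _ , ()
  ... | x ∷ w , sw-split , w-large , w-long
    with osc-++-largeˡ s t x w (xs≤max 0 t) w-large | pending-binary s t
  ... | osc≡ | inj₂ one =
    s ++ x ∷ w , t , sw-split , t-split , (x ∷ w , refl) , ⊑-refl t ,
    trans osc≡ (cong (_+ osc s t) one)
  ... | osc≡ | inj₁ none =
    Reachable-⊑ (x ∷ w , refl) (⊑-refl t)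
      (subst (Reachable (s ++ x ∷ w) t) (cong suc (trans osc≡ (cong (_+ osc s t) none)))
        (oscillateOnce-shorter (s ++ x ∷ w) t sw-split t-split
          (≤-length-suffix s (x ∷ w) w-long)))

lemma5 : (S T : List ℕ → Set) → Superperfect S → Superperfect T →
    (s t : List ℕ) → InfSplitting S s → InfSplitting T t →
    (n : ℕ) →
    ∃₂ λ s' t' → InfSplitting S s' × InfSplitting T t' ×
    s ⊑ s' × t ⊑ t' × osc s' t' ≡ osc s t + n
lemma5 S T S-sp T-sp s t s-split t-split zero =
  s , t , s-split , t-split , ⊑-refl s , ⊑-refl t , sym (+-identityʳ (osc s t))
lemma5 S T S-sp T-sp s t s-split t-split (suc n)
  with lemma5 S T S-sp T-sp s t s-split t-split n
... | s' , t' , s'-split , t'-split , s⊑s' , t⊑t' , osc≡ =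
  Reachable-⊑ S T S-sp T-sp s⊑s' t⊑t'
    (subst (Reachable S T S-sp T-sp s' t') (trans (cong suc osc≡) (sym (+-suc (osc s t) n)))
      (oscillateOnce S T S-sp T-sp s' t' s'-split t'-split))
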